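{- For any $K_k$-minor-free (simple) graph $G$ of maximum degree $\Delta$, the strong clique number of $G$ satisfies $\omega_2'(G)\le (k-1)(\Delta+1)$.
   Context: A strong clique of a graph $G$ is a set of edges every two of which share an endpoint or are joined by an edge of $G$ (an edge having one endpoint in common with each of them). The strong clique number $\omega_2'(G)$ is the maximum size of a strong clique; equivalently, the clique number of the square of the line graph of $G$. -}

module Defs where

open import Data.Nat using (ℕ; zero; suc; _+_; _*_; _∸_; _≤_; _⊔_)
open import Data.Fin using (Fin) renaming (_<_ to _<ᶠ_)
open import Data.Bool using (Bool; true; false; if_then_else_)
open import Data.Maybe using (Maybe; just; nothing)
open import Data.List using (List; []; _∷_; map; foldr; allFin; length)
open import Data.Nat.ListAction using (sum)
open import Data.List.Relation.Unary.AllPairs using (AllPairs)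
open import Data.List.Relation.Unary.Unique.Propositional using (Unique)
open import Data.List.Relation.Unary.All using (All)
open import Data.Product using (Σ; ∃; _×_; _,_; proj₁; proj₂)
open import Data.Sum using (_⊎_)
open import Relation.Binary.PropositionalEquality using (_≡_; _≢_)
open import Relation.Nullary using (¬_)

record SimpleGraph (n : ℕ) : Set where
  field
    adj   : Fin n → Fin n → Bool
    sym   : ∀ u v → adj u v ≡ adj v u
    irrefl : ∀ v → adj v v ≡ false

open SimpleGraph public

Adj : ∀ {n} → SimpleGraph n → Fin n → Fin n → Set
Adj G u v = adj G u v ≡ true

degree : ∀ {n} → SimpleGraph n → Fin n → ℕ
degree {n} G v = sum (map (λ u → if adj G v u then 1 else 0) (allFin n))

maxDegree : ∀ {n} → SimpleGraph n → ℕ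
maxDegree {n} G = foldr _⊔_ 0 (map (degree G) (allFin n))

data WalkIn {n} (G : SimpleGraph n) (P : Fin n → Set) : Fin n → Fin n → Set where
  here : ∀ {v} → P v → WalkIn G P v v
  step : ∀ {u w v} → P u → Adj G u w → WalkIn G P w v → WalkIn G P u v

-- A K_k minor model: each vertex is assigned to at most one branch set
-- (nothing = deleted); branch sets are nonempty, induce connected
-- subgraphs, and every two distinct branch sets are joined by an edge.
record KMinorModel {n} (k : ℕ) (G : SimpleGraph n) : Set where
  field
    branch    : Fin n → Maybe (Fin k)
    nonempty  : ∀ i → ∃ λ v → branch v ≡ just i
    connected : ∀ i u v → branch u ≡ just i → branch v ≡ just i →
                WalkIn G (λ w → branch w ≡ just i) u v
    joined    : ∀ i j → i ≢ j →
                ∃ λ u → ∃ λ v → branch u ≡ just i × branch v ≡ just j × Adj G u v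

HasKMinor : ∀ {n} → ℕ → SimpleGraph n → Set
HasKMinor k G = KMinorModel k G

KMinorFree : ∀ {n} → ℕ → SimpleGraph n → Set
KMinorFree k G = ¬ HasKMinor k G

-- An edge {u,v} represented canonically by the pair (u , v) with u < v.
IsEdge : ∀ {n} → SimpleGraph n → Fin n × Fin n → Set
IsEdge G (u , v) = u <ᶠ v × Adj G u v

ShareEndpoint : ∀ {n} → Fin n × Fin n → Fin n × Fin n → Set
ShareEndpoint (a , b) (c , d) = (a ≡ c ⊎ a ≡ d) ⊎ (b ≡ c ⊎ b ≡ d)

JoinedByEdge : ∀ {n} → SimpleGraph n → Fin n × Fin n → Fin n × Fin n → Set
JoinedByEdge G (a , b) (c , d) =
  (Adj G a c ⊎ Adj G a d) ⊎ (Adj G b c ⊎ Adj G b d)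

record StrongClique {n} (G : SimpleGraph n) (S : List (Fin n × Fin n)) : Set where
  field
    edges    : All (IsEdge G) S
    distinct : Unique S
    pairwise : AllPairs (λ e f → ShareEndpoint e f ⊎ JoinedByEdge G e f) S

module Submission where

-- Let S be a strong clique of G and Δ = Δ(G).  The edges of S form a simple
-- graph of maximum degree at most Δ, so by the bound |E| ≤ (Δ + 1) ν(E)
-- (ν the matching number) S contains a matching M with |S| ≤ (Δ + 1) |M|.
-- Any two disjoint edges of a strong clique are joined by an edge of G, so
-- contracting the edges of M yields a K_|M| minor; hence |M| ≤ k - 1.
--
-- The bound |E| ≤ (Δ + 1) ν(E) is proved by induction on |E|: if deleting a
-- vertex lowers ν, induct on the rest.  Otherwise every vertex is missed by
-- a maximum matching, and by Gallai's lemma two vertices missed by one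
-- maximum matching lie in different components; then either E splits into
-- two smaller parts, or E has at most 2ν + 1 non-isolated vertices and a
-- degree count finishes.

open import Data.Bool using (Bool; true; false; _∧_; _∨_; not; if_then_else_)
open import Data.Bool.Properties using (T-≡)
import Data.Bool.Properties as Boolₚ
open import Data.Empty using (⊥; ⊥-elim)
open import Data.Fin using (Fin; zero; suc; _≟_; inject≤) renaming (_<_ to _<ᶠ_)
open import Data.Fin.Properties using (any?)
import Data.Fin.Properties as Finₚ
open import Data.List using (List; []; _∷_; length; filterᵇ; _++_; allFin; map; foldr; tabulate; lookup)
import Data.List.Membership.DecPropositional as DecMembership
open import Data.List.Membership.Propositional using (_∈_)
open import Data.List.Membership.Propositional.Properties using (∈-filter⁺; ∈-filter⁻; ∈-lookup; ∈-allFin)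
open import Data.List.Properties using (length-++; length-filter; map-tabulate)
open import Data.List.Relation.Unary.All as All using (All; []; _∷_)
import Data.List.Relation.Unary.All.Properties as Allₚ
open import Data.List.Relation.Unary.AllPairs as AllPairs using (AllPairs; []; _∷_)
import Data.List.Relation.Unary.AllPairs.Properties as AllPairsₚ
open import Data.List.Relation.Unary.Any using (here; there)
open import Data.Maybe using (Maybe; just; nothing)
open import Data.Nat using (ℕ; zero; suc; _+_; _*_; _∸_; _≤_; _<_; z≤n; s≤s; _≤?_; _⊔_)
import Data.Nat as ℕ
open import Data.Nat.Induction using (<-wellFounded)
open import Data.Nat.ListAction using (sum)
open import Data.Nat.Properties hiding (_≟_)
open import Algebra.Properties.CommutativeMonoid.Sum +-0-commutativeMonoid
  using (sum-syntax; ∑-distrib-+; sum-cong-≗; sum-replicate-zero)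
open import Data.Product using (∃; _×_; _,_; proj₁; proj₂; map₂)
open import Data.Product.Properties using (≡-dec)
open import Data.Sum using (_⊎_; inj₁; inj₂; [_,_]′)
open import Function using (_∘_; id)
open import Function.Bundles using (Equivalence)
open import Induction.WellFounded using (Acc; acc)
open import Relation.Binary.Definitions using (DecidableEquality)
open import Relation.Binary.PropositionalEquality
  using (_≡_; _≢_; refl; sym; trans; cong; cong₂; subst; subst₂; module ≡-Reasoning)
open import Relation.Nullary using (¬_; Dec; yes; no; does)
open import Relation.Nullary.Decidable using (dec-true; dec-false; T?; ¬?; _×-dec_; _⊎-dec_)

open import Defs hiding (sym)

variable
  m n : ℕ
  A : Set


ind : Bool → ℕ
ind b = if b then 1 else 0

ind≤1 : ∀ b → ind b ≤ 1
ind≤1 true  = s≤s z≤n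
ind≤1 false = z≤n

true≢false : true ≢ false
true≢false ()

false≢true : false ≢ true
false≢true ()

_==_ : Fin m → Fin m → Bool
x == y = does (x ≟ y)

==-refl : (x : Fin m) → (x == x) ≡ true
==-refl x = dec-true (x ≟ x) refl

==-≢ : {x y : Fin m} → x ≢ y → (x == y) ≡ false
==-≢ {x = x} {y} = dec-false (x ≟ y)

==-sound : {x y : Fin m} → (x == y) ≡ true → x ≡ y
==-sound {x = x} {y} h with x ≟ y
... | yes x≡y = x≡y

∑-mono : {f g : Fin m → ℕ} → (∀ x → f x ≤ g x) → ∑[ x < m ] f x ≤ ∑[ x < m ] g x
∑-mono {zero}  h = z≤n
∑-mono {suc m} h = +-mono-≤ (h zero) (∑-mono (h ∘ suc))

∑-point : (a : Fin m) → ∑[ x < m ] ind (x == a) ≡ 1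
∑-point {suc m} zero    = cong suc (sum-replicate-zero m)
∑-point {suc m} (suc a) = ∑-point a

∑-*ʳ : (f : Fin m → ℕ) (c : ℕ) → ∑[ x < m ] (f x * c) ≡ (∑[ x < m ] f x) * c
∑-*ʳ {zero}  f c = refl
∑-*ʳ {suc m} f c = trans (cong (f zero * c +_) (∑-*ʳ (f ∘ suc) c))
                         (sym (*-distribʳ-+ c (f zero) _))

count : (Fin m → Bool) → ℕ
count {m} p = ∑[ x < m ] ind (p x)

count≤ : (p : Fin m → Bool) → count p ≤ m
count≤ {zero}  p = z≤n
count≤ {suc m} p = +-mono-≤ (ind≤1 (p zero)) (count≤ (p ∘ suc))

_∖_ : (Fin m → Bool) → Fin m → Fin m → Bool
(p ∖ o) y = p y ∧ not (y == o)

count-point : (p : Fin m → Bool) (o : Fin m) → count p ≡ ind (p o) + count (p ∖ o)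
count-point {m} p o = begin
  count p                                            ≡⟨ sum-cong-≗ split ⟩
  ∑[ y < m ] (ind ((p ∖ o) y) + δ y * ind (p o))     ≡⟨ ∑-distrib-+ (ind ∘ (p ∖ o)) _ ⟩
  count (p ∖ o) + ∑[ y < m ] (δ y * ind (p o))       ≡⟨ cong (count (p ∖ o) +_) (∑-*ʳ δ _) ⟩
  count (p ∖ o) + (∑[ y < m ] δ y) * ind (p o)       ≡⟨ cong (λ k → count (p ∖ o) + k * ind (p o)) (∑-point o) ⟩
  count (p ∖ o) + (ind (p o) + 0)                    ≡⟨ cong (count (p ∖ o) +_) (+-identityʳ _) ⟩
  count (p ∖ o) + ind (p o)                          ≡⟨ +-comm _ (ind (p o)) ⟩
  ind (p o) + count (p ∖ o)                          ∎
  where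
  open ≡-Reasoning
  δ : Fin m → ℕ
  δ y = ind (y == o)
  split : ∀ y → ind (p y) ≡ ind ((p ∖ o) y) + δ y * ind (p o)
  split y with y ≟ o
  ... | yes refl with p y
  ...   | true  = refl
  ...   | false = refl
  split y | no _ with p y
  ...   | true  = refl
  ...   | false = refl

count-remove : (p : Fin m → Bool) {o : Fin m} → p o ≡ true → count p ≡ suc (count (p ∖ o))
count-remove p {o} po = trans (count-point p o) (cong (λ b → ind b + count (p ∖ o)) po)

count-mono : {p q : Fin m → Bool} → (∀ y → p y ≡ true → q y ≡ true) → count p ≤ count q
count-mono {p = p} {q} p⊆q = ∑-mono pointwise
  where
  pointwise : ∀ y → ind (p y) ≤ ind (q y)
  pointwise y with p y in py
  ... | false = z≤n
  ... | true rewrite p⊆q y py = s≤s z≤n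

count-grow : {p q : Fin m → Bool} (x : Fin m) → (∀ y → p y ≡ true → q y ≡ true) →
  p x ≡ false → q x ≡ true → count p < count q
count-grow {p = p} {q} x p⊆q px qx = begin-strict
  count p              ≤⟨ count-mono p⊆q∖x ⟩
  count (q ∖ x)        <⟨ n<1+n _ ⟩
  suc (count (q ∖ x))  ≡⟨ count-remove q qx ⟨
  count q              ∎
  where
  open ≤-Reasoning
  p⊆q∖x : ∀ y → p y ≡ true → (q ∖ x) y ≡ true
  p⊆q∖x y py with y ≟ x
  ... | yes refl = ⊥-elim (false≢true (trans (sym px) py))
  ... | no _ rewrite p⊆q y py = refl

sum-allFin : (f : Fin n → ℕ) → sum (map f (allFin n)) ≡ ∑[ x < n ] f x
sum-allFin {n} f = trans (cong sum (map-tabulate id f)) (sum-tabulate f)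
  where
  sum-tabulate : ∀ {m} (g : Fin m → ℕ) → sum (tabulate g) ≡ ∑[ x < m ] g x
  sum-tabulate {zero}  g = refl
  sum-tabulate {suc m} g = cong (g zero +_) (sum-tabulate (g ∘ suc))


∈-filterᵇ⁻ : (p : A → Bool) {x : A} {xs : List A} → x ∈ filterᵇ p xs → x ∈ xs × p x ≡ true
∈-filterᵇ⁻ p x∈ = map₂ (Equivalence.to T-≡) (∈-filter⁻ (T? ∘ p) x∈)

∈-filterᵇ⁺ : (p : A → Bool) {x : A} {xs : List A} → x ∈ xs → p x ≡ true → x ∈ filterᵇ p xs
∈-filterᵇ⁺ p x∈ px = ∈-filter⁺ (T? ∘ p) x∈ (Equivalence.from T-≡ px)

length-partition : (p : A → Bool) (xs : List A) →
  length xs ≡ length (filterᵇ p xs) + length (filterᵇ (not ∘ p) xs)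
length-partition p []       = refl
length-partition p (x ∷ xs) with p x
... | true  = cong suc (length-partition p xs)
... | false = trans (cong suc (length-partition p xs)) (sym (+-suc _ _))

length-nonempty : {x : A} {xs : List A} → x ∈ xs → 0 < length xs
length-nonempty (here _)  = s≤s z≤n
length-nonempty (there _) = s≤s z≤n

allPairs-either : ∀ {R : A → A → Set} {xs : List A} → AllPairs R xs →
  ∀ {x y} → x ∈ xs → y ∈ xs → x ≢ y → R x y ⊎ R y x
allPairs-either (x⊥ ∷ _)  (here refl) (here refl) x≢y = ⊥-elim (x≢y refl)
allPairs-either (x⊥ ∷ _)  (here refl) (there y∈) _   = inj₁ (All.lookup x⊥ y∈)
allPairs-either (y⊥ ∷ _)  (there x∈) (here refl) _   = inj₂ (All.lookup y⊥ x∈)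
allPairs-either (_ ∷ xs⊥) (there x∈) (there y∈) x≢y  = allPairs-either xs⊥ x∈ y∈ x≢y

lookup-injective : {xs : List A} → AllPairs _≢_ xs → ∀ i j → lookup xs i ≡ lookup xs j → i ≡ j
lookup-injective (x∉ ∷ _)   zero    zero    _  = refl
lookup-injective (x∉ ∷ _)   zero    (suc j) eq = ⊥-elim (All.lookup x∉ (∈-lookup j) eq)
lookup-injective (x∉ ∷ _)   (suc i) zero    eq = ⊥-elim (All.lookup x∉ (∈-lookup i) (sym eq))
lookup-injective (_ ∷ xs!)  (suc i) (suc j) eq = cong suc (lookup-injective xs! i j eq)

≤-maximum : (h : A → ℕ) {xs : List A} {y : A} → y ∈ xs → h y ≤ foldr _⊔_ 0 (map h xs)
≤-maximum h {x ∷ xs} (here refl) = m≤m⊔n (h x) _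
≤-maximum h {x ∷ xs} (there y∈) = ≤-trans (≤-maximum h y∈) (m≤n⊔m (h x) _)


-- An edge is an ordered pair of vertices; graphs are handled through lists
-- of edges throughout.
Edge : ℕ → Set
Edge n = Fin n × Fin n

_≟ᵉ_ : DecidableEquality (Edge n)
_≟ᵉ_ = ≡-dec _≟_ _≟_

touches : Fin n → Edge n → Bool
touches x (a , b) = (x == a) ∨ (x == b)

touches-fst : (a b : Fin n) → touches a (a , b) ≡ true
touches-fst a b rewrite ==-refl a = refl

touches-snd : (a b : Fin n) → touches b (a , b) ≡ true
touches-snd a b rewrite ==-refl b with b == a
... | true  = refl
... | false = refl

touches-split : (x : Fin n) (e : Edge n) → touches x e ≡ true → x ≡ proj₁ e ⊎ x ≡ proj₂ e
touches-split x (a , b) t with x ≟ a | x ≟ b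
... | yes x≡a | _       = inj₁ x≡a
... | no _    | yes x≡b = inj₂ x≡b

other : Fin n → Edge n → Fin n
other x (a , b) with x == a
... | true  = b
... | false = a

touches-other : (x : Fin n) (e : Edge n) → touches (other x e) e ≡ true
touches-other x (a , b) with x == a
... | true  = touches-snd a b
... | false = touches-fst a b

other-ends : (z x : Fin n) (e : Edge n) → touches z e ≡ true → touches x e ≡ true →
  x ≡ z ⊎ x ≡ other z e
other-ends z x (a , b) tz tx with z ≟ a | touches-split z (a , b) tz | touches-split x (a , b) tx
... | yes refl | _        | inj₁ refl = inj₁ refl
... | yes refl | _        | inj₂ refl = inj₂ refl
... | no _     | inj₂ refl | inj₁ refl = inj₂ refl
... | no _     | inj₂ refl | inj₂ refl = inj₁ refl
... | no z≢a   | inj₁ z≡a | _        = ⊥-elim (z≢a z≡a)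

deg : List (Edge n) → Fin n → ℕ
deg []      x = 0
deg (e ∷ E) x = ind (touches x e) + deg E x

deg-zero : {E : List (Edge n)} {x : Fin n} → deg E x ≡ 0 → ∀ {f} → f ∈ E → touches x f ≡ false
deg-zero {E = e ∷ E} {x} d0 (here refl) with touches x e
... | false = refl
deg-zero {E = e ∷ E} {x} d0 (there f∈E) = deg-zero (m+n≡0⇒n≡0 (ind (touches x e)) d0) f∈E

deg-zero-intro : {E : List (Edge n)} {x : Fin n} → (∀ {f} → f ∈ E → touches x f ≡ false) → deg E x ≡ 0
deg-zero-intro {E = []}    h = refl
deg-zero-intro {E = e ∷ E} h = cong₂ _+_ (cong ind (h (here refl))) (deg-zero-intro (h ∘ there))

deg-nonzero : (E : List (Edge n)) (x : Fin n) → deg E x ≢ 0 → ∃ λ f → f ∈ E × touches x f ≡ true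
deg-nonzero []      x d≢0 = ⊥-elim (d≢0 refl)
deg-nonzero (e ∷ E) x d≢0 with touches x e in t
... | true  = e , here refl , t
... | false with deg-nonzero E x d≢0
... | f , f∈E , tf = f , there f∈E , tf

deg-filter≤ : (p : Edge n → Bool) (E : List (Edge n)) (x : Fin n) → deg (filterᵇ p E) x ≤ deg E x
deg-filter≤ p []      x = z≤n
deg-filter≤ p (e ∷ E) x with p e
... | true  = +-monoʳ-≤ (ind (touches x e)) (deg-filter≤ p E x)
... | false = ≤-trans (deg-filter≤ p E x) (m≤n+m _ _)

_-ᵛ_ : List (Edge n) → Fin n → List (Edge n)
E -ᵛ x = filterᵇ (not ∘ touches x) E

deg-split : (E : List (Edge n)) (x : Fin n) → length E ≡ length (E -ᵛ x) + deg E x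
deg-split []      x = refl
deg-split (e ∷ E) x with touches x e
... | true  = trans (cong suc (deg-split E x)) (sym (+-suc _ _))
... | false = cong suc (deg-split E x)

Loopless : Edge n → Set
Loopless (a , b) = a ≢ b

handshake : (E : List (Edge n)) → All Loopless E → ∑[ x < n ] deg E x ≡ length E + length E
handshake {n} []              []          = sum-replicate-zero n
handshake {n} ((a , b) ∷ E) (a≢b ∷ E↯) = begin
  ∑[ x < n ] (ind (touches x (a , b)) + deg E x)
    ≡⟨ ∑-distrib-+ (λ x → ind (touches x (a , b))) (deg E) ⟩
  ∑[ x < n ] ind (touches x (a , b)) + ∑[ x < n ] deg E x
    ≡⟨ cong₂ _+_ twoEnds (handshake E E↯) ⟩
  2 + (length E + length E)
    ≡⟨ cong suc (sym (+-suc (length E) (length E))) ⟩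
  suc (length E) + suc (length E)
    ∎
  where
  open ≡-Reasoning
  ends : ∀ x → ind (touches x (a , b)) ≡ ind (x == a) + ind (x == b)
  ends x with x ≟ a | x ≟ b
  ... | yes refl | yes refl = ⊥-elim (a≢b refl)
  ... | yes _    | no _     = refl
  ... | no _     | yes _    = refl
  ... | no _     | no _     = refl
  twoEnds : ∑[ x < n ] ind (touches x (a , b)) ≡ 2
  twoEnds = trans (sum-cong-≗ ends)
                  (trans (∑-distrib-+ (λ x → ind (x == a)) (λ x → ind (x == b)))
                         (cong₂ _+_ (∑-point a) (∑-point b)))

disjoint : Edge n → Edge n → Bool
disjoint (a , b) f = not (touches a f) ∧ not (touches b f)

Disjoint : Edge n → Edge n → Set
Disjoint e f = disjoint e f ≡ true

disjoint-apart : {e f : Edge n} (x : Fin n) → Disjoint e f → touches x e ≡ true → touches x f ≡ false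
disjoint-apart {e = a , b} {f} x d t with touches-split x (a , b) t | neither (touches a f) (touches b f) d
  where
  neither : ∀ s t → not s ∧ not t ≡ true → s ≡ false × t ≡ false
  neither false false _ = refl , refl
... | inj₁ refl | a∉f , _ = a∉f
... | inj₂ refl | _ , b∉f = b∉f

disjoint-intro : (e f : Edge n) → (∀ x → touches x e ≡ true → touches x f ≡ false) → Disjoint e f
disjoint-intro (a , b) f apart rewrite apart a (touches-fst a b) | apart b (touches-snd a b) = refl

disjoint-sym : {e f : Edge n} → Disjoint e f → Disjoint f e
disjoint-sym {e = e} {f} d = disjoint-intro f e apart
  where
  apart : ∀ x → touches x f ≡ true → touches x e ≡ false
  apart x tf with touches x e in te
  ... | false = refl
  ... | true with trans (sym (disjoint-apart x d te)) tf
  ... | ()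

disjoint-irrefl : {e : Edge n} → ¬ Disjoint e e
disjoint-irrefl {e = a , b} d with trans (sym (disjoint-apart a d (touches-fst a b))) (touches-fst a b)
... | ()


-- Matchings.

IsMatching : List (Edge n) → List (Edge n) → Set
IsMatching E M = All (_∈ E) M × AllPairs Disjoint M

IsMaximum : List (Edge n) → List (Edge n) → Set
IsMaximum E M = IsMatching E M × (∀ N → IsMatching E N → length N ≤ length M)

matching-deg≤1 : {M : List (Edge n)} → AllPairs Disjoint M → ∀ x → deg M x ≤ 1
matching-deg≤1 {M = []}    []           x = z≤n
matching-deg≤1 {M = f ∷ M} (f⊥M ∷ M⊥) x with touches x f in tf
... | false = matching-deg≤1 M⊥ x
... | true  = ≤-reflexive (cong suc (deg-zero-intro (λ g∈M → disjoint-apart x (All.lookup f⊥M g∈M) tf)))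

maximum-length : {E M M′ : List (Edge n)} → IsMaximum E M → IsMaximum E M′ → length M ≡ length M′
maximum-length (m , opt) (m′ , opt′) = ≤-antisym (opt′ _ m) (opt _ m′)

remove : Edge n → List (Edge n) → List (Edge n)
remove f = filterᵇ (λ g → not (does (f ≟ᵉ g)))

∈-remove⁻ : {f g : Edge n} (xs : List (Edge n)) → g ∈ remove f xs → g ∈ xs × f ≢ g
∈-remove⁻ {f = f} {g} xs g∈ with ∈-filterᵇ⁻ _ g∈
... | g∈xs , keep = g∈xs , λ f≡g → true≢false (trans (sym keep) (cong not (dec-true (f ≟ᵉ g) f≡g)))

length-remove : (f : Edge n) {xs : List (Edge n)} → AllPairs _≢_ xs → length xs ≤ suc (length (remove f xs))
length-remove f {[]}     []          = z≤n
length-remove f {x ∷ xs} (x∉xs ∷ xs!) with f ≟ᵉ x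
... | no _     = s≤s (length-remove f xs!)
... | yes refl = s≤s (≤-reflexive (cong length (sym (keepsAll xs x∉xs))))
  where
  keepsAll : ∀ ys → All (f ≢_) ys → remove f ys ≡ ys
  keepsAll []       []           = refl
  keepsAll (y ∷ ys) (f≢y ∷ f∉ys) rewrite dec-false (f ≟ᵉ y) f≢y = cong (y ∷_) (keepsAll ys f∉ys)

shared-swap : (q : Edge n → Bool) {e f : Edge n} (xs : List (Edge n)) → q e ≡ true → q f ≡ false →
  length (filterᵇ q (e ∷ remove f xs)) ≡ suc (length (filterᵇ q xs))
shared-swap q {e} {f} xs qe qf rewrite qe = cong suc (dropF xs)
  where
  dropF : ∀ ys → length (filterᵇ q (remove f ys)) ≡ length (filterᵇ q ys)
  dropF []       = refl
  dropF (y ∷ ys) with f ≟ᵉ y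
  ... | yes refl rewrite qf = dropF ys
  ... | no _ with q y
  ...   | true  = cong suc (dropF ys)
  ...   | false = dropF ys

matching-distinct : {M : List (Edge n)} → AllPairs Disjoint M → AllPairs _≢_ M
matching-distinct = AllPairs.map (λ {e} d e≡f → disjoint-irrefl {e = e} (subst (Disjoint e) (sym e≡f) d))

matching-pair : {M : List (Edge n)} → AllPairs Disjoint M →
  ∀ {e f} → e ∈ M → f ∈ M → e ≢ f → Disjoint e f
matching-pair M⊥ {e} {f} e∈M f∈M e≢f =
  [ id , disjoint-sym {e = f} {e} ]′ (allPairs-either M⊥ e∈M f∈M e≢f)

-- An edge whose endpoints are both missed by a maximum matching would
-- extend it; so no such edge exists.
no-augmenting-edge : {E M : List (Edge n)} {e : Edge n} → IsMaximum E M → e ∈ E →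
  (∀ x → touches x e ≡ true → deg M x ≡ 0) → ⊥
no-augmenting-edge {M = M} {e} ((M⊆E , M⊥) , opt) e∈E missed = 1+n≰n (opt (e ∷ M) extended)
  where
  extended : IsMatching _ (e ∷ M)
  extended = (e∈E ∷ M⊆E)
           , All.tabulate (λ f∈M → disjoint-intro e _ (λ x t → deg-zero (missed x t) f∈M)) ∷ M⊥

matchings-of-cons : (e : Edge n) (E : List (Edge n)) {A B : List (Edge n)} →
  IsMaximum E A → IsMaximum (filterᵇ (disjoint e) E) B →
  ∀ N → IsMatching (e ∷ E) N → length N ≤ length A ⊎ length N ≤ suc (length B)
matchings-of-cons e E (_ , optA) (_ , optB) N (N⊆eE , N⊥) with DecMembership._∈?_ _≟ᵉ_ e N
... | no e∉N = inj₁ (optA N (All.tabulate inE , N⊥))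
  where
  inE : ∀ {f} → f ∈ N → f ∈ E
  inE f∈N with All.lookup N⊆eE f∈N
  ... | here refl = ⊥-elim (e∉N f∈N)
  ... | there f∈E = f∈E
... | yes e∈N = inj₂ (≤-trans (length-remove e (matching-distinct N⊥))
                               (s≤s (optB (remove e N) (All.tabulate inE′ , AllPairsₚ.filter⁺ _ N⊥))))
  where
  inE′ : ∀ {f} → f ∈ remove e N → f ∈ filterᵇ (disjoint e) E
  inE′ f∈ with ∈-remove⁻ N f∈
  ... | f∈N , e≢f with All.lookup N⊆eE f∈N
  ...   | here refl = ⊥-elim (e≢f refl)
  ...   | there f∈E = ∈-filterᵇ⁺ _ f∈E (matching-pair N⊥ e∈N f∈N e≢f)

-- A maximum matching of e ∷ E is the longer of A, maximum for E, and e ∷ B,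
-- with B maximum among the edges of E disjoint from e.
maximum-cons : (e : Edge n) (E : List (Edge n)) {A B : List (Edge n)} →
  IsMaximum E A → IsMaximum (filterᵇ (disjoint e) E) B → ∃ (IsMaximum (e ∷ E))
maximum-cons e E {A} {B} maxA@((A⊆E , A⊥) , _) maxB@((B⊆E′ , B⊥) , _) = choose (length A ≤? suc (length B))
  where
  bound : ∀ N → IsMatching (e ∷ E) N → length N ≤ length A ⊎ length N ≤ suc (length B)
  bound = matchings-of-cons e E maxA maxB
  fromE′ : ∀ {f} → f ∈ filterᵇ (disjoint e) E → f ∈ E × Disjoint e f
  fromE′ = ∈-filterᵇ⁻ (disjoint e)
  withE : IsMatching (e ∷ E) (e ∷ B)
  withE = (here refl ∷ All.map (there ∘ proj₁ ∘ fromE′) B⊆E′)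
        , All.map (proj₂ ∘ fromE′) B⊆E′ ∷ B⊥
  choose : Dec (length A ≤ suc (length B)) → ∃ (IsMaximum (e ∷ E))
  choose (yes A≤eB) = e ∷ B , withE , λ N m → [ (λ h → ≤-trans h A≤eB) , id ]′ (bound N m)
  choose (no  A≰eB) = A , (All.map there A⊆E , A⊥) ,
    λ N m → [ id , (λ h → ≤-trans h (<⇒≤ (≰⇒> A≰eB))) ]′ (bound N m)

maximum-exists : (E : List (Edge n)) → ∃ (IsMaximum E)
maximum-exists {n} E = go E (<-wellFounded (length E))
  where
  go : (E : List (Edge n)) → Acc _<_ (length E) → ∃ (IsMaximum E)
  go []      _        = [] , ([] , []) , λ { [] _ → z≤n ; (f ∷ _) (() ∷ _ , _) }
  go (e ∷ E) (acc rs) =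
    maximum-cons e E (proj₂ (go E (rs ≤-refl)))
                     (proj₂ (go (filterᵇ (disjoint e) E) (rs (s≤s (length-filter (T? ∘ disjoint e) E)))))

maxMatching : List (Edge n) → List (Edge n)
maxMatching E = proj₁ (maximum-exists E)

maxMatching-maximum : (E : List (Edge n)) → IsMaximum E (maxMatching E)
maxMatching-maximum E = proj₂ (maximum-exists E)

ν : List (Edge n) → ℕ
ν E = length (maxMatching E)

matching-unique-at : {M : List (Edge n)} → AllPairs Disjoint M → ∀ {f g} x →
  f ∈ M → g ∈ M → touches x f ≡ true → touches x g ≡ true → f ≡ g
matching-unique-at M⊥ {f} {g} x f∈M g∈M tf tg with f ≟ᵉ g
... | yes f≡g = f≡g
... | no f≢g with trans (sym (disjoint-apart x (matching-pair M⊥ f∈M g∈M f≢g) tf)) tg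
... | ()

swap-maximum : {E M′ : List (Edge n)} {e f : Edge n} {z : Fin n} → IsMaximum E M′ → e ∈ E →
  touches z e ≡ true → deg M′ z ≡ 0 → f ∈ M′ → touches (other z e) f ≡ true →
  IsMaximum E (e ∷ remove f M′)
swap-maximum {M′ = M′} {e} {f} {z} ((M′⊆E , M′⊥) , optM′) e∈E tz dz f∈M′ tf =
  ( (e∈E ∷ All.tabulate (All.lookup M′⊆E ∘ proj₁ ∘ ∈-remove⁻ {f = f} M′))
  , All.tabulate e⊥rest ∷ AllPairsₚ.filter⁺ _ M′⊥ )
  , λ N matchN → ≤-trans (optM′ N matchN) (length-remove f (matching-distinct M′⊥))
  where
  e⊥rest : ∀ {g} → g ∈ remove f M′ → Disjoint e g
  e⊥rest {g} g∈ with ∈-remove⁻ {f = f} M′ g∈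
  ... | g∈M′ , f≢g = disjoint-intro e g apart
    where
    apart : ∀ x → touches x e ≡ true → touches x g ≡ false
    apart x tx with other-ends z x e tz tx
    ... | inj₁ refl = deg-zero dz g∈M′
    ... | inj₂ refl with touches (other z e) g in tg
    ...   | false = refl
    ...   | true  = ⊥-elim (f≢g (matching-unique-at M′⊥ (other z e) f∈M′ g∈M′ tf tg))

ends-missed : {M : List (Edge n)} {a b : Fin n} → deg M a ≡ 0 → deg M b ≡ 0 →
  ∀ x → touches x (a , b) ≡ true → deg M x ≡ 0
ends-missed {a = a} {b} da db x t with touches-split x (a , b) t
... | inj₁ refl = da
... | inj₂ refl = db


Linked : List (Edge n) → Fin n → Fin n → Set
Linked E y x = (y , x) ∈ E ⊎ (x , y) ∈ E

data Reachable (E : List (Edge n)) (u : Fin n) : Fin n → Set where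
  start  : Reachable E u u
  extend : ∀ {y x} → Reachable E u y → Linked E y x → Reachable E u x


-- Gallai's lemma.

AllInessential : List (Edge n) → Set
AllInessential E = ∀ w → ∃ λ M → IsMaximum E M × deg M w ≡ 0

module Gallai (E : List (Edge n)) (E↯ : All Loopless E)
              (inessential : AllInessential E) where

  CoMissed : Fin n → Fin n → Set
  CoMissed u v = ∃ λ M → IsMaximum E M × deg M u ≡ 0 × deg M v ≡ 0

  matching-loopless : ∀ {M} → IsMatching E M → All Loopless M
  matching-loopless (M⊆E , _) = All.map (All.lookup E↯) M⊆E

  linked-not-comissed : ∀ {a b} → Linked E a b → ¬ CoMissed a b
  linked-not-comissed (inj₁ ab∈E) (M , maxM , da , db) = no-augmenting-edge maxM ab∈E (ends-missed {M = M} da db)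
  linked-not-comissed (inj₂ ba∈E) (M , maxM , da , db) = no-augmenting-edge maxM ba∈E (ends-missed {M = M} db da)

  -- In the exchange argument M is a fixed maximum matching, and a second
  -- maximum matching M′ is moved towards M: the number of its edges lying
  -- in M grows at each step.
  module _ {M : List (Edge n)} (maxM : IsMaximum E M) where

    inM : Edge n → Bool
    inM g = does (DecMembership._∈?_ _≟ᵉ_ g M)

    shared : List (Edge n) → ℕ
    shared M′ = length (filterᵇ inM M′)

    Improvement : Fin n → List (Edge n) → Set
    Improvement w M′ = ∃ λ M″ → IsMaximum E M″ × deg M″ w ≡ 0 × shared M″ ≡ suc (shared M′)

    -- Let e ∈ M have an endpoint z ≠ w missed by M′.  Its
    -- other endpoint z′ is covered by some f ∈ M′ (else e augments M′), and
    -- e ∷ (M′ - f) is again maximum, still misses w, and has one more edge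
    -- in M, since f ∉ M.
    exchange : ∀ {w z e} M′ → IsMaximum E M′ → deg M′ w ≡ 0 → e ∈ M → touches z e ≡ true →
      deg M′ z ≡ 0 → z ≢ w → Improvement w M′
    exchange {w} {z} {e} M′ maxM′ dw e∈M tz dz z≢w with deg M′ (other z e) ℕ.≟ 0
    ... | yes dz′ = ⊥-elim (no-augmenting-edge maxM′ e∈E endsMissed)
      where
      e∈E : e ∈ E
      e∈E = All.lookup (proj₁ (proj₁ maxM)) e∈M
      endsMissed : ∀ x → touches x e ≡ true → deg M′ x ≡ 0
      endsMissed x tx with other-ends z x e tz tx
      ... | inj₁ refl = dz
      ... | inj₂ refl = dz′
    ... | no dz′≢0 with deg-nonzero M′ (other z e) dz′≢0
    ... | f , f∈M′ , tf =
      e ∷ remove f M′ , swap-maximum maxM′ (All.lookup (proj₁ (proj₁ maxM)) e∈M) tz dz f∈M′ tf ,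
      missesW , shared-swap inM M′ (dec-true (DecMembership._∈?_ _≟ᵉ_ e M) e∈M) f∉M
      where
      missesW : deg (e ∷ remove f M′) w ≡ 0
      missesW = cong₂ _+_ (cong ind w∉e) (n≤0⇒n≡0 (≤-trans (deg-filter≤ _ M′ w) (≤-reflexive dw)))
        where
        w∉e : touches w e ≡ false
        w∉e with touches w e in tw
        ... | false = refl
        ... | true with other-ends z w e tz tw
        ...   | inj₁ w≡z  = ⊥-elim (z≢w (sym w≡z))
        ...   | inj₂ refl = ⊥-elim (dz′≢0 dw)
      -- f ∈ M would share other z e with e ∈ M, hence equal e; but e meets
      -- z, which M′ ∋ f misses.
      f∉M : inM f ≡ false
      f∉M = dec-false (DecMembership._∈?_ _≟ᵉ_ f M) λ f∈M →
        false≢true (trans (sym (deg-zero dz f∈M′))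
                          (subst (λ g → touches z g ≡ true)
                                 (matching-unique-at (proj₂ (proj₁ maxM)) (other z e) e∈M f∈M (touches-other z e) tf)
                                 tz))

    -- Let M miss u ≠ v, and let M′ miss w ∉ {u, v} but cover
    -- u and v.  Then M covers a vertex z ≠ w missed by M′: otherwise, vertex
    -- by vertex, [x = u] + [x = v] + deg M x ≤ [x = w] + deg M′ x, and summing
    -- (handshake lemma) gives 2|M| + 2 ≤ 2|M′| + 1, although |M| = |M′|.
    exchange-vertex : ∀ {u v w} M′ → IsMaximum E M′ → deg M u ≡ 0 → deg M v ≡ 0 →
      u ≢ v → w ≢ u → w ≢ v → deg M′ u ≢ 0 → deg M′ v ≢ 0 →
      ∃ λ z → deg M z ≢ 0 × deg M′ z ≡ 0 × z ≢ w
    exchange-vertex {u} {v} {w} M′ maxM′ du dv u≢v w≢u w≢v du′≢0 dv′≢0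
      with any? (λ z → ¬? (deg M z ℕ.≟ 0) ×-dec (deg M′ z ℕ.≟ 0) ×-dec ¬? (z ≟ w))
    ... | yes found = found
    ... | no none   = ⊥-elim (1+n≰n (subst₂ _≤_ lhs rhs (∑-mono pointwise)))
      where
      L : ℕ
      L = length M
      pointwise : ∀ x → ind (x == u) + (ind (x == v) + deg M x) ≤ ind (x == w) + deg M′ x
      pointwise x with x ≟ w
      ... | yes refl rewrite ==-≢ w≢u | ==-≢ w≢v =
        ≤-trans (matching-deg≤1 (proj₂ (proj₁ maxM)) x) (s≤s z≤n)
      ... | no x≢w with x ≟ u
      ...   | yes refl rewrite ==-≢ u≢v | du = n≢0⇒n>0 du′≢0
      ...   | no x≢u with x ≟ v
      ...     | yes refl rewrite dv = n≢0⇒n>0 dv′≢0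
      ...     | no x≢v with deg M x ℕ.≟ 0 | deg M′ x ℕ.≟ 0
      ...       | yes dx | _        rewrite dx = z≤n
      ...       | no dx  | yes dx′  = ⊥-elim (none (x , dx , dx′ , x≢w))
      ...       | no _   | no dx′≢0 = ≤-trans (matching-deg≤1 (proj₂ (proj₁ maxM)) x) (n≢0⇒n>0 dx′≢0)
      lhs : ∑[ x < n ] (ind (x == u) + (ind (x == v) + deg M x)) ≡ suc (suc (L + L))
      lhs = trans (∑-distrib-+ (λ x → ind (x == u)) (λ x → ind (x == v) + deg M x))
                  (cong₂ _+_ (∑-point u)
                             (trans (∑-distrib-+ (λ x → ind (x == v)) (deg M))
                                    (cong₂ _+_ (∑-point v) (handshake M (matching-loopless (proj₁ maxM))))))
      rhs : ∑[ x < n ] (ind (x == w) + deg M′ x) ≡ suc (L + L)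
      rhs = trans (∑-distrib-+ (λ x → ind (x == w)) (deg M′))
                  (cong₂ _+_ (∑-point w)
                             (trans (handshake M′ (matching-loopless (proj₁ maxM′)))
                                    (cong (λ k → k + k) (maximum-length maxM′ maxM))))

    -- Let M miss u ≠ v, and w ∉ {u, v}.  Then w is missed, together with u
    -- or with v, by a maximum matching: start from one missing w and repeat
    -- the exchange step, which terminates as the edges shared with M grow.
    swap-missed : ∀ {u v w} → deg M u ≡ 0 → deg M v ≡ 0 → u ≢ v → w ≢ u → w ≢ v →
      CoMissed w u ⊎ CoMissed w v
    swap-missed {u} {v} {w} du dv u≢v w≢u w≢v with inessential w
    ... | M₀ , maxM₀ , dw₀ = improve M₀ maxM₀ dw₀ (<-wellFounded _)
      where
      improve : ∀ M′ → IsMaximum E M′ → deg M′ w ≡ 0 → Acc _<_ (length M ∸ shared M′) →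
        CoMissed w u ⊎ CoMissed w v
      improve M′ maxM′ dw (acc rs) with deg M′ u ℕ.≟ 0 | deg M′ v ℕ.≟ 0
      ... | yes du′ | _       = inj₁ (M′ , maxM′ , dw , du′)
      ... | no _    | yes dv′ = inj₂ (M′ , maxM′ , dw , dv′)
      ... | no du′  | no dv′ with exchange-vertex M′ maxM′ du dv u≢v w≢u w≢v du′ dv′
      ... | z , dz≢0 , dz′ , z≢w with deg-nonzero M z dz≢0
      ... | e , e∈M , tz with exchange M′ maxM′ dw e∈M tz dz′ z≢w
      ... | M″ , maxM″ , dw″ , grows =
        improve M″ maxM″ dw″ (rs (∸-monoʳ-< (≤-reflexive (sym grows)) bounded))
        where
        bounded : shared M″ ≤ length M
        bounded = ≤-trans (length-filter (T? ∘ inM) M″) (≤-reflexive (maximum-length maxM″ maxM))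

  comissed-sym : ∀ {u v} → CoMissed u v → CoMissed v u
  comissed-sym (M , maxM , du , dv) = M , maxM , dv , du

  -- Gallai's lemma: walk along the path; at each inner vertex y, the
  -- matching missing u can be traded for one missing y and u, or y and v.
  gallai : ∀ {u v} → Reachable E u v → u ≢ v → ¬ CoMissed u v
  gallai start                     u≢v _ = u≢v refl
  gallai {u} {v} (extend {y} walk link) u≢v c@(M , maxM , du , dv) with y ≟ u | y ≟ v
  ... | yes refl | _        = linked-not-comissed link c
  ... | no _     | yes refl = gallai walk u≢v c
  ... | no y≢u   | no y≢v with swap-missed maxM du dv u≢v y≢u y≢v
  ...   | inj₁ yu = gallai walk (λ u≡y → y≢u (sym u≡y)) (comissed-sym yu)
  ...   | inj₂ yv = linked-not-comissed link yv


-- Connected components.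

linked? : (E : List (Edge n)) (y x : Fin n) → Dec (Linked E y x)
linked? E y x = DecMembership._∈?_ _≟ᵉ_ (y , x) E ⊎-dec DecMembership._∈?_ _≟ᵉ_ (x , y) E

-- The component of u in E as a Boolean predicate on vertices: the balls
-- around u grow until they stabilise, which happens within n steps since
-- each proper growth adds a vertex.
module Component (E : List (Edge n)) (u : Fin n) where

  linkedTo? : (S : Fin n → Bool) (x : Fin n) → Dec (∃ λ y → S y ≡ true × Linked E y x)
  linkedTo? S x = any? (λ y → (S y Boolₚ.≟ true) ×-dec linked? E y x)

  ball : ℕ → Fin n → Bool
  ball zero    x = x == u
  ball (suc j) x = ball j x ∨ does (linkedTo? (ball j) x)

  ball-⊆ : ∀ j x → ball j x ≡ true → ball (suc j) x ≡ true
  ball-⊆ j x h rewrite h = refl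

  ball-centre : ∀ j → ball j u ≡ true
  ball-centre zero    = ==-refl u
  ball-centre (suc j) = ball-⊆ j u (ball-centre j)

  ball-reachable : ∀ j x → ball j x ≡ true → Reachable E u x
  ball-reachable zero    x h with ==-sound {x = x} {u} h
  ... | refl = start
  ball-reachable (suc j) x h with ball j x in bx | linkedTo? (ball j) x
  ... | true  | _                    = ball-reachable j x bx
  ... | false | yes (y , by , link)  = extend (ball-reachable j y by) link

  Stable : ℕ → Set
  Stable j = ∀ x → ball (suc j) x ≡ true → ball j x ≡ true

  stable-or-grows : ∀ j → Stable j ⊎ count (ball j) < count (ball (suc j))
  stable-or-grows j with any? (λ x → (ball (suc j) x Boolₚ.≟ true) ×-dec (ball j x Boolₚ.≟ false))
  ... | yes (x , new , old) = inj₂ (count-grow x (ball-⊆ j) old new)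
  ... | no none = inj₁ stable
    where
    stable : Stable j
    stable x new = Boolₚ.¬-not (λ old → none (x , new , old))

  stabilises : ∃ Stable
  stabilises with grows n
    where
    grows : ∀ j → ∃ Stable ⊎ j < count (ball j)
    grows zero = inj₂ (subst (0 <_) (sym (∑-point u)) (s≤s z≤n))
    grows (suc j) with grows j
    ... | inj₁ st = inj₁ st
    ... | inj₂ j<cⱼ with stable-or-grows j
    ...   | inj₁ st    = inj₁ (j , st)
    ...   | inj₂ cⱼ<cⱼ₊₁ = inj₂ (≤-trans (s≤s j<cⱼ) cⱼ<cⱼ₊₁)
  ... | inj₁ st  = st
  ... | inj₂ n<c = ⊥-elim (<⇒≱ n<c (count≤ (ball n)))

  component : Fin n → Bool
  component = ball (proj₁ stabilises)

  component-centre : component u ≡ true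
  component-centre = ball-centre (proj₁ stabilises)

  component-reachable : ∀ x → component x ≡ true → Reachable E u x
  component-reachable = ball-reachable (proj₁ stabilises)

  component-closed : ∀ {a b} → Linked E a b → component a ≡ true → component b ≡ true
  component-closed {a} {b} link ca = proj₂ stabilises b
    (trans (cong (component b ∨_) (dec-true (linkedTo? component b) (a , ca , link))) (Boolₚ.∨-zeroʳ _))

  component-edge : ∀ {a b} → (a , b) ∈ E → component a ≡ component b
  component-edge {a} {b} ab∈E with component a in ca | component b in cb
  ... | true  | true  = refl
  ... | false | false = refl
  ... | true  | false with trans (sym (component-closed {a} {b} (inj₁ ab∈E) ca)) cb
  ...   | ()
  component-edge {a} {b} ab∈E | false | true with trans (sym (component-closed {b} {a} (inj₂ ab∈E) cb)) ca
  ...   | ()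

  component-endpoint : ∀ {e} → e ∈ E → ∀ x → touches x e ≡ true → component x ≡ component (proj₁ e)
  component-endpoint {a , b} e∈E x t with touches-split x (a , b) t
  ... | inj₁ refl = refl
  ... | inj₂ refl = sym (component-edge e∈E)


Canonical : Edge n → Set
Canonical (a , b) = a <ᶠ b

canonical-loopless : {e : Edge n} → Canonical e → Loopless e
canonical-loopless = Finₚ.<⇒≢

other-≢ : (x : Fin n) (e : Edge n) → Canonical e → touches x e ≡ true → other x e ≢ x
other-≢ x (a , b) a<b t with touches-split x (a , b) t
... | inj₁ refl rewrite ==-refl x = λ b≡x → Finₚ.<⇒≢ a<b (sym b≡x)
... | inj₂ refl rewrite ==-≢ (λ b≡a → Finₚ.<⇒≢ a<b (sym b≡a)) = Finₚ.<⇒≢ a<b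

other-injective : (x : Fin n) (e f : Edge n) → Canonical e → Canonical f →
  touches x e ≡ true → touches x f ≡ true → other x e ≡ other x f → e ≡ f
other-injective x (a , b) (c , d) a<b c<d te tf eq
  with touches-split x (a , b) te | touches-split x (c , d) tf
... | inj₁ refl | inj₁ refl rewrite ==-refl x = cong (x ,_) eq
... | inj₁ refl | inj₂ refl rewrite ==-refl x | ==-≢ (λ d≡c → Finₚ.<⇒≢ c<d (sym d≡c)) =
  ⊥-elim (Finₚ.<-asym a<b (subst (_<ᶠ x) (sym eq) c<d))
... | inj₂ refl | inj₁ refl rewrite ==-refl x | ==-≢ (λ b≡a → Finₚ.<⇒≢ a<b (sym b≡a)) =
  ⊥-elim (Finₚ.<-asym a<b (subst (x <ᶠ_) (sym eq) c<d))
... | inj₂ refl | inj₂ refl rewrite ==-≢ (λ b≡a → Finₚ.<⇒≢ a<b (sym b≡a))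
                                  | ==-≢ (λ d≡c → Finₚ.<⇒≢ c<d (sym d≡c)) = cong (_, x) eq

deg≤count : (E : List (Edge n)) (x : Fin n) (p : Fin n → Bool) → All Canonical E → AllPairs _≢_ E →
  (∀ {e} → e ∈ E → touches x e ≡ true → p (other x e) ≡ true) → deg E x ≤ count p
deg≤count []      x p _          _            _   = z≤n
deg≤count {n} (e ∷ E) x p (ce ∷ E-ok) (e∉E ∷ E!) leads with touches x e in te
... | false = deg≤count E x p E-ok E! (leads ∘ there)
... | true  = begin
  suc (deg E x)        ≤⟨ s≤s (deg≤count E x (p ∖ o) E-ok E! leads′) ⟩
  suc (count (p ∖ o))  ≡⟨ count-remove p (leads (here refl) te) ⟨
  count p              ∎
  where
  open ≤-Reasoning
  o : Fin n
  o = other x e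
  leads′ : ∀ {f} → f ∈ E → touches x f ≡ true → (p ∖ o) (other x f) ≡ true
  leads′ {f} f∈E tf rewrite leads (there f∈E) tf
    | ==-≢ (λ same → All.lookup e∉E f∈E (sym (other-injective x f e (All.lookup E-ok f∈E) ce tf te same))) = refl


-- Edges versus matchings: |E| ≤ (Δ + 1) · ν(E).

record Bounded (Δ : ℕ) (E : List (Edge n)) : Set where
  field
    canonical : All Canonical E
    distinct  : AllPairs _≢_ E
    degree≤   : ∀ x → deg E x ≤ Δ
open Bounded

bounded-filter : ∀ {Δ} (p : Edge n → Bool) {E : List (Edge n)} → Bounded Δ E → Bounded Δ (filterᵇ p E)
bounded-filter p {E} bnd = record
  { canonical = Allₚ.filter⁺ (T? ∘ p) (canonical bnd)
  ; distinct  = AllPairsₚ.filter⁺ (T? ∘ p) (distinct bnd)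
  ; degree≤   = λ x → ≤-trans (deg-filter≤ p E x) (degree≤ bnd x)
  }

bounded-loopless : ∀ {Δ} {E : List (Edge n)} → Bounded Δ E → All Loopless E
bounded-loopless bnd = All.map canonical-loopless (canonical bnd)

LargeMatching : ℕ → List (Edge n) → Set
LargeMatching Δ E = ∃ λ M → IsMatching E M × length E ≤ suc Δ * length M

Smaller : ℕ → List (Edge n) → Set
Smaller {n} Δ E = ∀ (E′ : List (Edge n)) → length E′ < length E → Bounded Δ E′ → LargeMatching Δ E′

-- Case 1: deleting some vertex x lowers the matching number.  Then x lies on
-- an edge, and induction on E - x gives
-- |E| = |E - x| + deg x ≤ (Δ + 1)(ν - 1) + Δ < (Δ + 1) ν.
via-essential-vertex : ∀ {Δ} {E M N : List (Edge n)} x → Bounded Δ E → Smaller Δ E →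
  IsMaximum E M → IsMaximum (E -ᵛ x) N → length N < length M → LargeMatching Δ E
via-essential-vertex {n} {Δ} {E} {M} {N} x bnd smaller (matchM@(M⊆E , M⊥) , _) (_ , optN) N<M =
  M , matchM , bound
  where
  x-covered : deg E x ≢ 0
  x-covered d0 = <⇒≱ N<M (optN M (All.tabulate avoidsX , M⊥))
    where
    avoidsX : ∀ {f} → f ∈ M → f ∈ E -ᵛ x
    avoidsX f∈M = ∈-filterᵇ⁺ _ (All.lookup M⊆E f∈M) (cong not (deg-zero d0 (All.lookup M⊆E f∈M)))
  shorter : length (E -ᵛ x) < length E
  shorter = subst (length (E -ᵛ x) <_) (sym (deg-split E x)) (m<m+n _ (n≢0⇒n>0 x-covered))
  rest : LargeMatching Δ (E -ᵛ x)
  rest = smaller (E -ᵛ x) shorter (bounded-filter _ bnd)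
  M₁ : List (Edge n)
  M₁ = proj₁ rest
  M₁-matching : IsMatching (E -ᵛ x) M₁
  M₁-matching = proj₁ (proj₂ rest)
  bound : length E ≤ suc Δ * length M
  bound = begin
    length E                     ≡⟨ deg-split E x ⟩
    length (E -ᵛ x) + deg E x    ≤⟨ +-mono-≤ (proj₂ (proj₂ rest)) (≤-trans (degree≤ bnd x) (n≤1+n Δ)) ⟩
    suc Δ * length M₁ + suc Δ    ≡⟨ +-comm _ (suc Δ) ⟩
    suc Δ + suc Δ * length M₁    ≡⟨ *-suc (suc Δ) (length M₁) ⟨
    suc Δ * suc (length M₁)      ≤⟨ *-monoʳ-≤ (suc Δ) (≤-trans (s≤s (optN M₁ M₁-matching)) N<M) ⟩
    suc Δ * length M             ∎
    where open ≤-Reasoning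

Respects : (Fin n → Bool) → List (Edge n) → Set
Respects S E = ∀ {e} → e ∈ E → ∀ x → touches x e ≡ true → S x ≡ S (proj₁ e)

sideᵗ sideᶠ : (Fin n → Bool) → List (Edge n) → List (Edge n)
sideᵗ S = filterᵇ (S ∘ proj₁)
sideᶠ S = filterᵇ (not ∘ S ∘ proj₁)

-- Matchings of the two sides of E share no vertex, so they combine.
combine-sides : ∀ {Δ} {E : List (Edge n)} (S : Fin n → Bool) → Respects S E →
  LargeMatching Δ (sideᵗ S E) → LargeMatching Δ (sideᶠ S E) → LargeMatching Δ E
combine-sides {Δ = Δ} {E} S respects (M₁ , (M₁⊆ , M₁⊥) , E₁≤) (M₂ , (M₂⊆ , M₂⊥) , E₂≤) =
  M₁ ++ M₂
  , (Allₚ.++⁺ (All.map (proj₁ ∘ from₁) M₁⊆) (All.map (proj₁ ∘ from₂) M₂⊆)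
    , AllPairsₚ.++⁺ M₁⊥ M₂⊥ (All.tabulate λ f∈M₁ → All.tabulate λ g∈M₂ → apart f∈M₁ g∈M₂))
  , bound
  where
  from₁ : ∀ {f} → f ∈ sideᵗ S E → f ∈ E × S (proj₁ f) ≡ true
  from₁ = ∈-filterᵇ⁻ (S ∘ proj₁)
  from₂ : ∀ {f} → f ∈ sideᶠ S E → f ∈ E × not (S (proj₁ f)) ≡ true
  from₂ = ∈-filterᵇ⁻ (not ∘ S ∘ proj₁)
  inside : ∀ {f} → f ∈ M₁ → ∀ x → touches x f ≡ true → S x ≡ true
  inside f∈M₁ x t with from₁ (All.lookup M₁⊆ f∈M₁)
  ... | f∈E , Sf = trans (respects f∈E x t) Sf
  outside : ∀ {g} → g ∈ M₂ → ∀ x → touches x g ≡ true → S x ≡ false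
  outside g∈M₂ x t with from₂ (All.lookup M₂⊆ g∈M₂)
  ... | g∈E , ¬Sg = trans (respects g∈E x t) (Boolₚ.not-injective ¬Sg)
  apart : ∀ {f g} → f ∈ M₁ → g ∈ M₂ → Disjoint f g
  apart {f} {g} f∈M₁ g∈M₂ = disjoint-intro f g λ x tf → Boolₚ.¬-not λ tg →
    true≢false (trans (sym (inside f∈M₁ x tf)) (outside g∈M₂ x tg))
  bound : length E ≤ suc Δ * length (M₁ ++ M₂)
  bound = begin
    length E                                ≡⟨ length-partition (S ∘ proj₁) E ⟩
    length (sideᵗ S E) + length (sideᶠ S E) ≤⟨ +-mono-≤ E₁≤ E₂≤ ⟩
    suc Δ * length M₁ + suc Δ * length M₂   ≡⟨ *-distribˡ-+ (suc Δ) (length M₁) (length M₂) ⟨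
    suc Δ * (length M₁ + length M₂)         ≡⟨ cong (suc Δ *_) (length-++ M₁) ⟨
    suc Δ * length (M₁ ++ M₂)               ∎
    where open ≤-Reasoning

via-split : ∀ {Δ} {E : List (Edge n)} (S : Fin n → Bool) → Respects S E →
  ∀ {e₁ e₂} → e₁ ∈ E → S (proj₁ e₁) ≡ true → e₂ ∈ E → S (proj₁ e₂) ≡ false →
  Bounded Δ E → Smaller Δ E → LargeMatching Δ E
via-split {Δ = Δ} {E} S respects e₁∈E Se₁ e₂∈E Se₂ bnd smaller =
  combine-sides {Δ = Δ} S respects (smaller (sideᵗ S E) shorterᵗ (bounded-filter (S ∘ proj₁) bnd))
                                   (smaller (sideᶠ S E) shorterᶠ (bounded-filter (not ∘ S ∘ proj₁) bnd))
  where
  shorterᵗ : length (sideᵗ S E) < length E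
  shorterᵗ = subst (length (sideᵗ S E) <_) (sym (length-partition (S ∘ proj₁) E))
                   (m<m+n _ (length-nonempty (∈-filterᵇ⁺ (not ∘ S ∘ proj₁) e₂∈E (cong not Se₂))))
  shorterᶠ : length (sideᶠ S E) < length E
  shorterᶠ = subst (length (sideᶠ S E) <_) (sym (length-partition (S ∘ proj₁) E))
                   (m<n+m _ (length-nonempty (∈-filterᵇ⁺ (S ∘ proj₁) e₁∈E Se₁)))

MissedPair : List (Edge n) → List (Edge n) → Set
MissedPair E M = ∃ λ u → ∃ λ v → u ≢ v × deg E u ≢ 0 × deg E v ≢ 0 × deg M u ≡ 0 × deg M v ≡ 0

missed-pair? : (E M : List (Edge n)) → Dec (MissedPair E M)
missed-pair? E M = any? λ u → any? λ v →
  ¬? (u ≟ v) ×-dec ¬? (deg E u ℕ.≟ 0) ×-dec ¬? (deg E v ℕ.≟ 0)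
             ×-dec (deg M u ℕ.≟ 0) ×-dec (deg M v ℕ.≟ 0)

-- Case 2: every vertex is missed by some maximum matching, and a maximum
-- matching M misses two distinct vertices u, v lying on edges.  By
-- Gallai's lemma v is outside the component of u, so E splits along it.
via-comissed-pair : ∀ {Δ} {E M : List (Edge n)} → Bounded Δ E → Smaller Δ E →
  AllInessential E → IsMaximum E M → MissedPair E M → LargeMatching Δ E
via-comissed-pair {E = E} {M} bnd smaller inessential maxM (u , v , u≢v , du , dv , mu , mv)
  with deg-nonzero E u du | deg-nonzero E v dv
... | eᵤ , eᵤ∈E , tu | eᵥ , eᵥ∈E , tv =
  via-split component component-endpoint
    eᵤ∈E (trans (sym (component-endpoint eᵤ∈E u tu)) component-centre)
    eᵥ∈E (trans (sym (component-endpoint eᵥ∈E v tv)) v-outside)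
    bnd smaller
  where
  open Component E u
  open Gallai E (bounded-loopless bnd) inessential using (gallai)
  v-outside : component v ≡ false
  v-outside = Boolₚ.¬-not λ cv → gallai (component-reachable v cv) u≢v (M , maxM , mu , mv)

nonzero : ℕ → Bool
nonzero zero    = false
nonzero (suc _) = true

covered : List (Edge n) → Fin n → Bool
covered E x = nonzero (deg E x)

covered-endpoint : {E : List (Edge n)} {e : Edge n} (x : Fin n) → e ∈ E → touches x e ≡ true → covered E x ≡ true
covered-endpoint {E = E} x e∈E t with deg E x in dx
... | zero  = ⊥-elim (false≢true (trans (sym (deg-zero dx e∈E)) t))
... | suc _ = refl

-- Summing degrees, each of the N covered vertices contributes at most Δ ...
double-edges≤NΔ : ∀ {Δ} {E : List (Edge n)} → Bounded Δ E → length E + length E ≤ count (covered E) * Δ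
double-edges≤NΔ {n} {Δ} {E} bnd = begin
  length E + length E                ≡⟨ handshake E (bounded-loopless bnd) ⟨
  ∑[ x < n ] deg E x                 ≤⟨ ∑-mono pointwise ⟩
  ∑[ x < n ] (ind (covered E x) * Δ) ≡⟨ ∑-*ʳ (ind ∘ covered E) Δ ⟩
  count (covered E) * Δ              ∎
  where
  open ≤-Reasoning
  pointwise : ∀ x → deg E x ≤ ind (covered E x) * Δ
  pointwise x with deg E x | degree≤ bnd x
  ... | zero  | _   = z≤n
  ... | suc _ | d≤Δ = ≤-trans d≤Δ (≤-reflexive (sym (+-identityʳ Δ)))

-- ... and at most N - 1, as its neighbours are other covered vertices.
double-edges≤N[N-1] : ∀ {Δ} {E : List (Edge n)} → Bounded Δ E →
  length E + length E ≤ count (covered E) * (count (covered E) ∸ 1)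
double-edges≤N[N-1] {n} {Δ} {E} bnd = begin
  length E + length E                      ≡⟨ handshake E (bounded-loopless bnd) ⟨
  ∑[ x < n ] deg E x                       ≤⟨ ∑-mono pointwise ⟩
  ∑[ x < n ] (ind (covered E x) * (N ∸ 1)) ≡⟨ ∑-*ʳ (ind ∘ covered E) (N ∸ 1) ⟩
  N * (N ∸ 1)                              ∎
  where
  open ≤-Reasoning
  N : ℕ
  N = count (covered E)
  pointwise : ∀ x → deg E x ≤ ind (covered E x) * (N ∸ 1)
  pointwise x with deg E x in dx
  ... | zero  = z≤n
  ... | suc k = begin
    suc k                     ≡⟨ dx ⟨
    deg E x                   ≤⟨ deg≤count E x (covered E ∖ x) (canonical bnd) (distinct bnd) leads ⟩
    count (covered E ∖ x)     ≡⟨ cong (_∸ 1) (count-remove (covered E) (cong nonzero dx)) ⟨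
    N ∸ 1                     ≡⟨ +-identityʳ (N ∸ 1) ⟨
    (N ∸ 1) + 0               ∎
    where
    leads : ∀ {e} → e ∈ E → touches x e ≡ true → (covered E ∖ x) (other x e) ≡ true
    leads {e} e∈E t rewrite covered-endpoint (other x e) e∈E (touches-other x e)
                          | ==-≢ (other-≢ x e (All.lookup (canonical bnd) e∈E) t) = refl


-- If at most one covered vertex is missed by the matching M, then there are
-- at most 2|M| + 1 covered vertices (M itself covers exactly 2|M|).
covered≤ : {E M : List (Edge n)} → All Loopless M →
  ¬ MissedPair E M →
  count (covered E) ≤ suc (length M + length M)
covered≤ {n} {E} {M} M↯ noPair
  with any? (λ y → ¬? (deg E y ℕ.≟ 0) ×-dec (deg M y ℕ.≟ 0))
... | yes (y , dy , my) = begin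
  count (covered E)                   ≤⟨ ∑-mono pointwise ⟩
  ∑[ x < n ] (ind (x == y) + deg M x) ≡⟨ ∑-distrib-+ (λ x → ind (x == y)) (deg M) ⟩
  ∑[ x < n ] ind (x == y) + ∑[ x < n ] deg M x ≡⟨ cong₂ _+_ (∑-point y) (handshake M M↯) ⟩
  suc (length M + length M)           ∎
  where
  open ≤-Reasoning
  pointwise : ∀ x → ind (covered E x) ≤ ind (x == y) + deg M x
  pointwise x with x ≟ y | deg E x in dx
  ... | yes _   | d     = ≤-trans (ind≤1 (nonzero d)) (s≤s z≤n)
  ... | no _    | zero  = z≤n
  ... | no x≢y  | suc _ with deg M x ℕ.≟ 0
  ...   | yes mx   = ⊥-elim (noPair (x , y , x≢y , (λ d0 → 1+n≢0 (trans (sym dx) d0)) , dy , mx , my))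
  ...   | no mx≢0 = n≢0⇒n>0 mx≢0
... | no none = ≤-trans (∑-mono pointwise) (≤-trans (≤-reflexive (handshake M M↯)) (n≤1+n _))
  where
  pointwise : ∀ x → ind (covered E x) ≤ deg M x
  pointwise x with deg E x ℕ.≟ 0 | deg M x ℕ.≟ 0
  ... | yes d0 | _       rewrite d0 = z≤n
  ... | no d≢0 | yes m0  = ⊥-elim (none (x , d≢0 , m0))
  ... | no d≢0 | no m≢0  = ≤-trans (ind≤1 (covered E x)) (n≢0⇒n>0 m≢0)

-- Arithmetic core of the last case: A ≤ NΔ, A ≤ N(N - 1) and N ≤ 2μ + 1
-- give A ≤ (Δ + 1) 2μ (use the second bound if N ≤ Δ + 1, else the first).
double-bound : ∀ N Δ μ A → A ≤ N * Δ → A ≤ N * (N ∸ 1) → N ≤ suc (μ + μ) → A ≤ suc Δ * (μ + μ)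
double-bound N Δ μ A A≤NΔ A≤N[N-1] N≤ with N ≤? suc Δ
... | yes N≤1+Δ = begin
  A                  ≤⟨ A≤N[N-1] ⟩
  N * (N ∸ 1)        ≤⟨ *-monoˡ-≤ (N ∸ 1) N≤1+Δ ⟩
  suc Δ * (N ∸ 1)    ≤⟨ *-monoʳ-≤ (suc Δ) (∸-monoˡ-≤ 1 N≤) ⟩
  suc Δ * (μ + μ)    ∎
  where open ≤-Reasoning
... | no N≰1+Δ = large N (≰⇒> N≰1+Δ) A≤NΔ N≤
  where
  open ≤-Reasoning
  large : ∀ N → suc Δ < N → A ≤ N * Δ → N ≤ suc (μ + μ) → A ≤ suc Δ * (μ + μ)
  large (suc N′) (s≤s Δ<N′) A≤ (s≤s N′≤) = begin
    A                ≤⟨ A≤ ⟩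
    Δ + N′ * Δ       ≤⟨ +-monoˡ-≤ (N′ * Δ) (<⇒≤ Δ<N′) ⟩
    N′ + N′ * Δ      ≡⟨ *-suc N′ Δ ⟨
    N′ * suc Δ       ≡⟨ *-comm N′ (suc Δ) ⟩
    suc Δ * N′       ≤⟨ *-monoʳ-≤ (suc Δ) N′≤ ⟩
    suc Δ * (μ + μ)  ∎

-- Case 3: at most one covered vertex is missed by the maximum matching M.
-- Then there are at most 2ν + 1 covered vertices and counting degrees
-- gives 2|E| ≤ 2 (Δ + 1) ν.
via-small-support : ∀ {Δ} {E M : List (Edge n)} → Bounded Δ E → IsMatching E M →
  ¬ MissedPair E M → LargeMatching Δ E
via-small-support {Δ = Δ} {E} {M} bnd matchM noPair = M , matchM , halve twice
  where
  M↯ : All Loopless M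
  M↯ = All.map (All.lookup (bounded-loopless bnd)) (proj₁ matchM)
  twice : length E + length E ≤ suc Δ * length M + suc Δ * length M
  twice = subst (length E + length E ≤_) (*-distribˡ-+ (suc Δ) (length M) (length M))
            (double-bound (count (covered E)) Δ (length M) _
               (double-edges≤NΔ bnd) (double-edges≤N[N-1] bnd) (covered≤ {E = E} M↯ noPair))
  halve : ∀ {a b} → a + a ≤ b + b → a ≤ b
  halve {a} {b} a+a≤b+b with a ≤? b
  ... | yes a≤b = a≤b
  ... | no  a≰b = ⊥-elim (<⇒≱ (+-mono-< (≰⇒> a≰b) (≰⇒> a≰b)) a+a≤b+b)

-- If no vertex deletion lowers the matching number, every vertex w is
-- missed by a maximum matching: a maximum matching of E - w.
all-inessential : (E : List (Edge n)) → (∀ w → ν E ≤ ν (E -ᵛ w)) → AllInessential E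
all-inessential {n} E notLower w with maxMatching-maximum (E -ᵛ w)
... | (N⊆E-w , N⊥) , _ =
  N , ((All.map (proj₁ ∘ fromE-w) N⊆E-w , N⊥) , optimal) , deg-zero-intro (missesW ∘ All.lookup N⊆E-w)
  where
  N : List (Edge n)
  N = maxMatching (E -ᵛ w)
  fromE-w : ∀ {f} → f ∈ E -ᵛ w → f ∈ E × not (touches w f) ≡ true
  fromE-w = ∈-filterᵇ⁻ (not ∘ touches w)
  missesW : ∀ {f} → f ∈ E -ᵛ w → touches w f ≡ false
  missesW = Boolₚ.not-injective ∘ proj₂ ∘ fromE-w
  optimal : ∀ N′ → IsMatching E N′ → length N′ ≤ length N
  optimal N′ m = ≤-trans (proj₂ (maxMatching-maximum E) N′ m) (notLower w)

large-matching-step : ∀ {Δ} (E : List (Edge n)) → Bounded Δ E → Smaller Δ E → LargeMatching Δ E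
large-matching-step E bnd smaller
  with any? (λ x → suc (ν (E -ᵛ x)) ≤? ν E) | missed-pair? E (maxMatching E)
... | yes (x , lower) | _ =
  via-essential-vertex x bnd smaller (maxMatching-maximum E) (maxMatching-maximum (E -ᵛ x)) lower
... | no noneLower | yes pair =
  via-comissed-pair bnd smaller (all-inessential E λ w → ≮⇒≥ λ lower → noneLower (w , lower))
                    (maxMatching-maximum E) pair
... | no _ | no noPair = via-small-support bnd (proj₁ (maxMatching-maximum E)) noPair

large-matching : ∀ {Δ} (E : List (Edge n)) → Bounded Δ E → LargeMatching Δ E
large-matching {n} E = go E (<-wellFounded (length E))
  where
  go : ∀ {Δ} (E : List (Edge n)) → Acc _<_ (length E) → Bounded Δ E → LargeMatching Δ E
  go E (acc rs) bnd = large-matching-step E bnd (λ E′ shorter → go E′ (rs shorter))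


-- Strong cliques: degrees and clique minors.

module _ {n : ℕ} (G : SimpleGraph n) where

  adj-sym : ∀ {a b} → Adj G a b → Adj G b a
  adj-sym {a} {b} ab = trans (SimpleGraph.sym G b a) ab

  edge-canonical : ∀ {e} → IsEdge G e → Canonical e
  edge-canonical {_ , _} = proj₁

  edges-deg≤ : ∀ {S} → All (IsEdge G) S → AllPairs _≢_ S → ∀ x → deg S x ≤ maxDegree G
  edges-deg≤ {S} S⊆G S! x = begin
    deg S x                    ≤⟨ deg≤count S x (adj G x) (All.map edge-canonical S⊆G) S! leads ⟩
    count (adj G x)            ≡⟨ sum-allFin (ind ∘ adj G x) ⟨
    degree G x                 ≤⟨ ≤-maximum (degree G) (∈-allFin x) ⟩
    maxDegree G                ∎
    where
    open ≤-Reasoning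
    leads : ∀ {e} → e ∈ S → touches x e ≡ true → adj G x (other x e) ≡ true
    leads {a , b} e∈S t with All.lookup S⊆G e∈S | touches-split x (a , b) t
    ... | a<b , ab | inj₁ refl rewrite ==-refl x = ab
    ... | a<b , ab | inj₂ refl rewrite ==-≢ (λ b≡a → Finₚ.<⇒≢ a<b (sym b≡a)) = adj-sym ab

  clique-bounded : ∀ {S} → StrongClique G S → Bounded (maxDegree G) S
  clique-bounded clique = record
    { canonical = All.map edge-canonical (StrongClique.edges clique)
    ; distinct  = StrongClique.distinct clique
    ; degree≤   = edges-deg≤ (StrongClique.edges clique) (StrongClique.distinct clique)
    }

  joining-edge : ∀ {e f} → Disjoint e f → ShareEndpoint e f ⊎ JoinedByEdge G e f →
    ∃ λ u → ∃ λ v → touches u e ≡ true × touches v f ≡ true × Adj G u v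
  joining-edge {a , b} {c , d} e⊥f (inj₁ shared) = ⊥-elim (noCommon shared)
    where
    common : ∀ x → touches x (a , b) ≡ true → touches x (c , d) ≡ true → ⊥
    common x tx tx′ with trans (sym (disjoint-apart x e⊥f tx)) tx′
    ... | ()
    noCommon : ShareEndpoint (a , b) (c , d) → ⊥
    noCommon (inj₁ (inj₁ refl)) = common a (touches-fst a b) (touches-fst a d)
    noCommon (inj₁ (inj₂ refl)) = common a (touches-fst a b) (touches-snd c a)
    noCommon (inj₂ (inj₁ refl)) = common b (touches-snd a b) (touches-fst b d)
    noCommon (inj₂ (inj₂ refl)) = common b (touches-snd a b) (touches-snd c b)
  joining-edge {a , b} {c , d} _ (inj₂ (inj₁ (inj₁ ac))) = a , c , touches-fst a b , touches-fst c d , ac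
  joining-edge {a , b} {c , d} _ (inj₂ (inj₁ (inj₂ ad))) = a , d , touches-fst a b , touches-snd c d , ad
  joining-edge {a , b} {c , d} _ (inj₂ (inj₂ (inj₁ bc))) = b , c , touches-snd a b , touches-fst c d , bc
  joining-edge {a , b} {c , d} _ (inj₂ (inj₂ (inj₂ bd))) = b , d , touches-snd a b , touches-snd c d , bd

  edge-walk : (P : Fin n → Set) {a b u v : Fin n} → Adj G a b → P a → P b →
    u ≡ a ⊎ u ≡ b → v ≡ a ⊎ v ≡ b → WalkIn G P u v
  edge-walk P ab pa pb (inj₁ refl) (inj₁ refl) = here pa
  edge-walk P ab pa pb (inj₁ refl) (inj₂ refl) = step pa ab (here pb)
  edge-walk P ab pa pb (inj₂ refl) (inj₁ refl) = step pb (adj-sym ab) (here pa)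
  edge-walk P ab pa pb (inj₂ refl) (inj₂ refl) = here pb

  -- Contracting k pairwise disjoint edges of a strong clique S gives a K_k
  -- minor: the branch sets are the edges themselves, each connected, and any
  -- two of them are joined by an edge of G.
  module MatchingMinor {S M : List (Edge n)} (clique : StrongClique G S)
                       (M⊆S : All (_∈ S) M) (M⊥ : AllPairs Disjoint M)
                       {k : ℕ} (k≤ : k ≤ length M) where

    open StrongClique clique

    ed : Fin k → Edge n
    ed i = lookup M (inject≤ i k≤)

    ed∈S : ∀ i → ed i ∈ S
    ed∈S i = All.lookup M⊆S (∈-lookup (inject≤ i k≤))

    ed-disjoint : ∀ {i j} → i ≢ j → Disjoint (ed i) (ed j)
    ed-disjoint {i} {j} i≢j = matching-pair M⊥ (∈-lookup _) (∈-lookup _) λ same →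
      i≢j (Finₚ.inject≤-injective k≤ k≤ i j (lookup-injective (matching-distinct M⊥) _ _ same))

    ed-distinct : ∀ {i j} → i ≢ j → ed i ≢ ed j
    ed-distinct {i} {j} i≢j same = disjoint-irrefl {e = ed i} (subst (Disjoint (ed i)) (sym same) (ed-disjoint i≢j))

    one-branch : ∀ {x i j} → touches x (ed i) ≡ true → touches x (ed j) ≡ true → i ≡ j
    one-branch {x} {i} {j} ti tj with i ≟ j
    ... | yes i≡j = i≡j
    ... | no i≢j with trans (sym (disjoint-apart x (ed-disjoint i≢j) ti)) tj
    ...   | ()

    branch : Fin n → Maybe (Fin k)
    branch x with any? (λ i → touches x (ed i) Boolₚ.≟ true)
    ... | yes (i , _) = just i
    ... | no _        = nothing

    branch-sound : ∀ {x} i → branch x ≡ just i → touches x (ed i) ≡ true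
    branch-sound {x} i h with any? (λ i → touches x (ed i) Boolₚ.≟ true)
    branch-sound {x} i refl | yes (.i , ti) = ti

    branch-complete : ∀ {x} i → touches x (ed i) ≡ true → branch x ≡ just i
    branch-complete {x} i ti with any? (λ i → touches x (ed i) Boolₚ.≟ true)
    ... | yes (j , tj) = cong just (one-branch {x} tj ti)
    ... | no none      = ⊥-elim (none (i , ti))

    connected : ∀ i u v → branch u ≡ just i → branch v ≡ just i → WalkIn G (λ w → branch w ≡ just i) u v
    connected i u v bu bv with ed i in edi | All.lookup edges (ed∈S i)
    ... | a , b | _ , ab = edge-walk _ ab
      (branch-complete i (subst (λ e → touches a e ≡ true) (sym edi) (touches-fst a b)))
      (branch-complete i (subst (λ e → touches b e ≡ true) (sym edi) (touches-snd a b)))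
      (touches-split u (a , b) (subst (λ e → touches u e ≡ true) edi (branch-sound i bu)))
      (touches-split v (a , b) (subst (λ e → touches v e ≡ true) edi (branch-sound i bv)))

    joined : ∀ i j → i ≢ j → ∃ λ u → ∃ λ v → branch u ≡ just i × branch v ≡ just j × Adj G u v
    joined i j i≢j with allPairs-either pairwise (ed∈S i) (ed∈S j) (ed-distinct i≢j)
    ... | inj₁ r with joining-edge (ed-disjoint i≢j) r
    ...   | u , v , tu , tv , uv = u , v , branch-complete i tu , branch-complete j tv , uv
    joined i j i≢j | inj₂ r with joining-edge (ed-disjoint (i≢j ∘ sym)) r
    ...   | v , u , tv , tu , vu = u , v , branch-complete i tu , branch-complete j tv , adj-sym vu

    model : KMinorModel k G
    model = record
      { branch    = branch
      ; nonempty  = λ i → proj₁ (ed i) , branch-complete i (touches-fst (proj₁ (ed i)) (proj₂ (ed i)))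
      ; connected = connected
      ; joined    = joined
      }


theorem1p9 : ∀ (k n : ℕ) (G : SimpleGraph n) → KMinorFree k G →
    (S : List (Fin n × Fin n)) → StrongClique G S →
    length S ≤ (k ∸ 1) * suc (maxDegree G)
theorem1p9 k n G minorFree S clique
  with large-matching S (clique-bounded G clique)
... | M , (M⊆S , M⊥) , S≤ with k ≤? length M
...   | yes k≤M = ⊥-elim (minorFree (MatchingMinor.model G clique M⊆S M⊥ k≤M))
...   | no  k≰M = begin
  length S                  ≤⟨ S≤ ⟩
  suc Δ * length M          ≤⟨ *-monoʳ-≤ (suc Δ) M≤k-1 ⟩
  suc Δ * (k ∸ 1)           ≡⟨ *-comm (suc Δ) (k ∸ 1) ⟩
  (k ∸ 1) * suc Δ           ∎
  where
  open ≤-Reasoning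
  Δ : ℕ
  Δ = maxDegree G
  M≤k-1 : length M ≤ k ∸ 1
  M≤k-1 = subst (length M ≤_) (pred[m∸n]≡m∸[1+n] k 0) (suc[m]≤n⇒m≤pred[n] (≰⇒> k≰M))
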